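{- Let $G$ be a finite, simple, undirected, connected graph with a cut-vertex $v$, and let $C_1,\dots,C_k$ be the connected components of $G-v$. If, for each $i$, $S_i$ is an MEG-set of the induced subgraph $G[C_i\cup\{v\}]$, then $S=(S_1\cup\dots\cup S_k)\setminus\{v\}$ is an MEG-set of $G$.
   Context: Two vertices $x,y$ of a graph $H$ monitor an edge $e$ if $e$ belongs to all shortest paths between $x$ and $y$ in $H$; a set $S\subseteq V(H)$ is an MEG-set of $H$ if for every edge $e$ of $H$ some pair $x,y\in S$ monitors $e$ in $H$. A cut-vertex is a vertex whose removal increases the number of connected components. -}

module Defs where

open import Data.Nat using (ℕ; zero; suc; _≤_)
open import Data.Fin using (Fin)
open import Data.Product using (Σ; ∃; _×_; _,_)
open import Data.Sum using (_⊎_)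
open import Relation.Nullary using (¬_)
open import Relation.Binary.PropositionalEquality using (_≡_; _≢_)
open import Function.Bundles using (_⇔_)

-- A simple undirected graph on a vertex type V: symmetric, irreflexive
-- adjacency relation (no loops, no multi-edges: an edge is just a pair
-- of adjacent vertices).
record Graph (V : Set) : Set₁ where
  field
    Adj    : V → V → Set
    sym    : ∀ {x y} → Adj x y → Adj y x
    irrefl : ∀ {x} → ¬ Adj x x
open Graph public

module _ {V : Set} (G : Graph V) where

  data Walk : V → V → Set where
    []  : ∀ {x} → Walk x x
    _∷_ : ∀ {x y z} → Adj G x y → Walk y z → Walk x z

  len : ∀ {x y} → Walk x y → ℕ
  len []      = zero
  len (_ ∷ p) = suc (len p)

  Shortest : ∀ {x y} → Walk x y → Set
  Shortest {x} {y} p = ∀ (q : Walk x y) → len p ≤ len q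

  data Traverses (a b : V) : ∀ {x y} → Walk x y → Set where
    here  : ∀ {z} (e : Adj G a b) (p : Walk b z) → Traverses a b (e ∷ p)
    there : ∀ {x y z} (e : Adj G x y) {p : Walk y z} →
            Traverses a b p → Traverses a b (e ∷ p)

  EdgeOn : (a b : V) → ∀ {x y} → Walk x y → Set
  EdgeOn a b p = Traverses a b p ⊎ Traverses b a p

  Monitors : (x y a b : V) → Set
  Monitors x y a b = ∀ (p : Walk x y) → Shortest p → EdgeOn a b p

  IsMEGSet : (V → Set) → Set
  IsMEGSet S = ∀ a b → Adj G a b →
    Σ V λ x → Σ V λ y → S x × S y × Monitors x y a b

  Connected : Set
  Connected = ∀ x y → Walk x y

Induced : {V : Set} → Graph V → (P : V → Set) → Graph (Σ V P)
Induced G P = record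
  { Adj    = λ { (a , _) (b , _) → Adj G a b }
  ; sym    = λ e → sym G e
  ; irrefl = λ e → irrefl G e }

_─_ : {V : Set} → Graph V → (v : V) → Graph (Σ V λ u → u ≢ v)
G ─ v = Induced G (λ u → u ≢ v)

IsCutVertex : {V : Set} → Graph V → V → Set
IsCutVertex G v = Σ (Σ _ λ u → u ≢ v) λ a → Σ (Σ _ λ u → u ≢ v) λ b →
  ¬ Walk (G ─ v) a b

-- comp : V → Fin k labels the connected components C_0..C_{k-1} of G - v:
-- each label is used by some vertex ≠ v, and two vertices ≠ v get the same
-- label iff they are joined by a walk in G - v. (The value at v is irrelevant.)
IsComponentLabelling : {n : ℕ} → Graph (Fin n) → (v : Fin n) →
  (k : ℕ) → (Fin n → Fin k) → Set
IsComponentLabelling G v k comp =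
  (∀ i → Σ (Fin _) λ u → u ≢ v × comp u ≡ i) ×
  (∀ u w (hu : u ≢ v) (hw : w ≢ v) →
     (comp u ≡ comp w) ⇔ Walk (G ─ v) (u , hu) (w , hw))

CompPlus : {n k : ℕ} → (v : Fin n) → (Fin n → Fin k) → Fin k → Fin n → Set
CompPlus v comp i u = (u ≢ v × comp u ≡ i) ⊎ u ≡ v

{-# OPTIONS --safe #-}
-- Every edge lies in some G[C_i ∪ {v}], and a shortest path of G between two vertices of
-- C_i ∪ {v} stays inside it: leaving it means leaving and re-entering through v. So a pair
-- of S_i monitoring the edge in G[C_i ∪ {v}] monitors it in G. If that pair uses v, replace
-- v by a vertex w of S from another component: every w-path into C_i passes through v and
-- its tail from v is again shortest.
module Submission where

open import Defs
open import Data.Nat using (ℕ; suc; _≤_; _<_; _+_; s≤s; z≤n)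
open import Data.Nat.Properties using (m≤n+m; <⇒≱; +-comm; +-cancelˡ-≤)
open import Data.Fin using (Fin; _≟_)
open import Data.Product using (Σ; _×_; _,_; proj₁; proj₂)
open import Data.Sum using (_⊎_; inj₁; inj₂)
open import Data.Empty using (⊥-elim)
open import Relation.Nullary using (¬_; yes; no)
open import Relation.Unary using (Decidable)
open import Relation.Binary.PropositionalEquality
  using (_≡_; _≢_; refl; trans; cong; subst; subst₂) renaming (sym to ≡-sym)
open import Function.Bundles using (Equivalence)

module Walks {V : Set} (G : Graph V) where

  infixr 5 _++_
  _++_ : ∀ {x y z} → Walk G x y → Walk G y z → Walk G x z
  []      ++ q = q
  (e ∷ p) ++ q = e ∷ (p ++ q)

  len-++ : ∀ {x y z} (p : Walk G x y) (q : Walk G y z) →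
           len G (p ++ q) ≡ len G p + len G q
  len-++ []      q = refl
  len-++ (e ∷ p) q = cong suc (len-++ p q)

  traverses-++ʳ : ∀ {a b x y z} (p : Walk G x y) {q : Walk G y z} →
                  Traverses G a b q → Traverses G a b (p ++ q)
  traverses-++ʳ []      t = t
  traverses-++ʳ (e ∷ p) t = there e (traverses-++ʳ p t)

  edgeOn-++ʳ : ∀ {a b x y z} (p : Walk G x y) {q : Walk G y z} →
               EdgeOn G a b q → EdgeOn G a b (p ++ q)
  edgeOn-++ʳ p (inj₁ t) = inj₁ (traverses-++ʳ p t)
  edgeOn-++ʳ p (inj₂ t) = inj₂ (traverses-++ʳ p t)

  traverses-++⁻ : ∀ {a b x y z} (p : Walk G x y) (q : Walk G y z) →
                  Traverses G a b (p ++ q) → Traverses G a b p ⊎ Traverses G a b q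
  traverses-++⁻ []      q t                  = inj₂ t
  traverses-++⁻ (e ∷ p) q (here .e .(p ++ q)) = inj₁ (here e p)
  traverses-++⁻ (e ∷ p) q (there .e t) with traverses-++⁻ p q t
  ... | inj₁ t′ = inj₁ (there e t′)
  ... | inj₂ t′ = inj₂ t′

  traverses-adj : ∀ {a b x y} {p : Walk G x y} → Traverses G a b p → Adj G a b
  traverses-adj (here e _)   = e
  traverses-adj (there _ t)  = traverses-adj t

  reverse : ∀ {x y} → Walk G x y → Walk G y x
  reverse []      = []
  reverse (e ∷ p) = reverse p ++ (sym G e ∷ [])

  len-reverse : ∀ {x y} (p : Walk G x y) → len G (reverse p) ≡ len G p
  len-reverse []      = refl
  len-reverse (e ∷ p) =
    trans (len-++ (reverse p) (sym G e ∷ []))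
          (trans (+-comm (len G (reverse p)) 1) (cong suc (len-reverse p)))

  traverses-reverse : ∀ {a b x y} (p : Walk G x y) →
                      Traverses G a b (reverse p) → Traverses G b a p
  traverses-reverse (e ∷ p) t with traverses-++⁻ (reverse p) (sym G e ∷ []) t
  ... | inj₁ t′          = there e (traverses-reverse p t′)
  ... | inj₂ (here _ _)  = here e p

  shortest-reverse : ∀ {x y} (p : Walk G x y) → Shortest G p → Shortest G (reverse p)
  shortest-reverse p sp q =
    subst₂ _≤_ (≡-sym (len-reverse p)) (len-reverse q) (sp (reverse q))

  monitors-sym : ∀ {x y a b} → Monitors G x y a b → Monitors G y x a b
  monitors-sym m p sp with m (reverse p) (shortest-reverse p sp)
  ... | inj₁ t = inj₂ (traverses-reverse p t)
  ... | inj₂ t = inj₁ (traverses-reverse p t)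

  ¬monitors-self : ∀ {x a b} → ¬ Monitors G x x a b
  ¬monitors-self m with m [] (λ _ → z≤n)
  ... | inj₁ ()
  ... | inj₂ ()

  shortest-suffix : ∀ {x y z} (pre : Walk G x y) (suf : Walk G y z) →
                    Shortest G (pre ++ suf) → Shortest G suf
  shortest-suffix pre suf sp r = +-cancelˡ-≤ (len G pre) _ _
    (subst₂ _≤_ (len-++ pre suf) (len-++ pre r) (sp (pre ++ r)))

  monitors-through : ∀ {w v y a b} →
    (∀ (p : Walk G w y) → Σ (Walk G w v) λ pre → Σ (Walk G v y) λ suf → pre ++ suf ≡ p) →
    Monitors G v y a b → Monitors G w y a b
  monitors-through split m p sp with split p
  ... | pre , suf , refl = edgeOn-++ʳ pre (m suf (shortest-suffix pre suf sp))

  SoleEdgeAt : V → V → V → Set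
  SoleEdgeAt x a b = ∀ {u} → Adj G u x → (u ≡ a × x ≡ b) ⊎ (u ≡ b × x ≡ a)

  last-edge : ∀ {w z x} (e : Adj G w z) (r : Walk G z x) →
              Σ V λ u → Traverses G u x (e ∷ r)
  last-edge {w} e []       = w , here e []
  last-edge     e (f ∷ r) with last-edge f r
  ... | u , t = u , there e t

  monitors-at-leaf : ∀ {w x a b} → SoleEdgeAt x a b → w ≢ x → Monitors G w x a b
  monitors-at-leaf sole w≢x []      _ = ⊥-elim (w≢x refl)
  monitors-at-leaf sole w≢x (e ∷ r) _ with last-edge e r
  ... | u , t with sole (traverses-adj t)
  ...   | inj₁ (refl , refl) = inj₁ t
  ...   | inj₂ (refl , refl) = inj₂ t

module InducedWalks {V : Set} (G : Graph V) (P : V → Set) where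

  private
    I = Induced G P

  forget : ∀ {s t} → Walk I s t → Walk G (proj₁ s) (proj₁ t)
  forget []      = []
  forget (e ∷ q) = e ∷ forget q

  len-forget : ∀ {s t} (q : Walk I s t) → len G (forget q) ≡ len I q
  len-forget []      = refl
  len-forget (e ∷ q) = cong suc (len-forget q)

  traverses-forget : ∀ {a b s t} (q : Walk I s t) →
                     Traverses I a b q → Traverses G (proj₁ a) (proj₁ b) (forget q)
  traverses-forget (e ∷ q) (here .e .q) = here e (forget q)
  traverses-forget (e ∷ q) (there .e t) = there e (traverses-forget q t)

  edgeOn-forget : ∀ {a b s t} (q : Walk I s t) →
                  EdgeOn I a b q → EdgeOn G (proj₁ a) (proj₁ b) (forget q)
  edgeOn-forget q (inj₁ t) = inj₁ (traverses-forget q t)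
  edgeOn-forget q (inj₂ t) = inj₂ (traverses-forget q t)

  -- (x , hx) and (x , hy) are distinct vertices of I when hx ≢ hy: non-adjacent twins.
  twins-distance-two : ∀ {x hx hy a b} → Monitors I (x , hx) (x , hy) a b →
                       (q : Walk I (x , hx) (x , hy)) → 2 ≤ len I q
  twins-distance-two m []            = ⊥-elim (Walks.¬monitors-self I m)
  twins-distance-two m (e ∷ [])      = ⊥-elim (irrefl G e)
  twins-distance-two m (_ ∷ (_ ∷ _)) = s≤s (s≤s z≤n)

  twins-monitor-every-edge : ∀ {x hx hy a b} → Monitors I (x , hx) (x , hy) a b →
    ∀ {u} → P u → Adj G u x →
    (u ≡ proj₁ a × x ≡ proj₁ b) ⊎ (u ≡ proj₁ b × x ≡ proj₁ a)
  twins-monitor-every-edge m {u} hu f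
    with m (_∷_ {y = u , hu} (sym G f) (f ∷ [])) (twins-distance-two m)
  ... | inj₁ (here _ _)             = inj₂ (refl , refl)
  ... | inj₁ (there _ (here _ _))   = inj₁ (refl , refl)
  ... | inj₂ (here _ _)             = inj₁ (refl , refl)
  ... | inj₂ (there _ (here _ _))   = inj₂ (refl , refl)

-- P plays the role of C ∪ {v} for a component C of G - v.
module Gated {V : Set} (G : Graph V) {P : V → Set} (P? : Decidable P) (v : V)
  (gate : ∀ {x z} → Adj G x z → P x → ¬ P z → x ≡ v) where

  open Walks G
  open InducedWalks G P

  private
    I = Induced G P

  enters-through-gate : ∀ {z y} → ¬ P z → P y → (p : Walk G z y) →
    Σ (Walk G z v) λ pre → Σ (Walk G v y) λ suf → pre ++ suf ≡ p
  enters-through-gate ¬pz py []                    = ⊥-elim (¬pz py)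
  enters-through-gate ¬pz py (_∷_ {y = w} e p) with P? w
  ... | yes pw with gate (sym G e) pw ¬pz
  ...   | refl = e ∷ [] , p , refl
  enters-through-gate ¬pz py (e ∷ p) | no ¬pw with enters-through-gate ¬pw py p
  ...   | pre , suf , refl = e ∷ pre , suf , refl

  -- A walk leaving P must come back through v, where it already started.
  lift-or-shorten : ∀ {x z y} (hx : P x) (hy : P y) (e : Adj G x z) (p : Walk G z y) →
    (Σ (Walk I (x , hx) (y , hy)) λ q → forget q ≡ e ∷ p) ⊎
    (Σ (Walk G x y) λ p′ → len G p′ < len G (e ∷ p))
  lift-or-shorten hx hy e [] = inj₁ (e ∷ [] , refl)
  lift-or-shorten {z = z} hx hy e (f ∷ p) with P? z
  ... | yes hz with lift-or-shorten hz hy f p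
  ...   | inj₁ (q , eq)    = inj₁ (e ∷ q , cong (e ∷_) eq)
  ...   | inj₂ (p′ , p′<p) = inj₂ (e ∷ p′ , s≤s p′<p)
  lift-or-shorten hx hy e (f ∷ p) | no ¬hz with gate e hx ¬hz
  ... | refl with enters-through-gate ¬hz hy (f ∷ p)
  ...   | pre , suf , eq = inj₂ (suf , s≤s suf≤p)
    where
    suf≤p : len G suf ≤ len G (f ∷ p)
    suf≤p = subst (λ r → len G suf ≤ len G r) eq
              (subst (len G suf ≤_) (≡-sym (len-++ pre suf)) (m≤n+m _ _))

  monitors-lift : ∀ {x y hx hy a b} → x ≢ y → Monitors I (x , hx) (y , hy) a b →
                  Monitors G x y (proj₁ a) (proj₁ b)
  monitors-lift x≢y m []      _  = ⊥-elim (x≢y refl)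
  monitors-lift {hx = hx} {hy} x≢y m (e ∷ p) sp with lift-or-shorten hx hy e p
  ... | inj₂ (p′ , p′<p) = ⊥-elim (<⇒≱ p′<p (sp p′))
  ... | inj₁ (q , eq)    = subst (EdgeOn G _ _) eq (edgeOn-forget q (m q shortest-q))
    where
    shortest-q : Shortest I q
    shortest-q q′ = subst₂ _≤_ (trans (cong (len G) (≡-sym eq)) (len-forget q)) (len-forget q′)
                      (sp (forget q′))

  monitors-from-outside : ∀ {w y hv hy a b} → ¬ P w → v ≢ y →
    Monitors I (v , hv) (y , hy) a b → Monitors G w y (proj₁ a) (proj₁ b)
  monitors-from-outside {hy = hy} ¬pw v≢y m =
    monitors-through (enters-through-gate ¬pw hy) (monitors-lift v≢y m)

  -- Twins inside P, other than v, can only monitor the edge of a leaf.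
  monitors-from-twins : ∀ {w x hx hy a b} → x ≢ v → w ≢ x →
    Monitors I (x , hx) (x , hy) a b → Monitors G w x (proj₁ a) (proj₁ b)
  monitors-from-twins {x = x} {hx} x≢v w≢x m = monitors-at-leaf sole w≢x
    where
    sole : SoleEdgeAt x _ _
    sole {u} f with P? u
    ... | yes hu = twins-monitor-every-edge m hu f
    ... | no ¬hu = ⊥-elim (x≢v (gate (sym G f) hx ¬hu))

module CutVertexComponents {n k : ℕ} (G : Graph (Fin n)) (v : Fin n)
  (comp : Fin n → Fin k) (lab : IsComponentLabelling G v k comp) where

  open Walks G

  same-component : ∀ {u w} → Adj G u w → u ≢ v → w ≢ v → comp u ≡ comp w
  same-component {u} {w} e u≢v w≢v = Equivalence.from (proj₂ lab u w u≢v w≢v) (e ∷ [])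

  compPlus-comp : ∀ {i w} → CompPlus v comp i w → w ≢ v → comp w ≡ i
  compPlus-comp (inj₁ (_ , eq)) _   = eq
  compPlus-comp (inj₂ w≡v)      w≢v = ⊥-elim (w≢v w≡v)

  compPlus? : ∀ i → Decidable (CompPlus v comp i)
  compPlus? i u with u ≟ v
  ... | yes u≡v = yes (inj₂ u≡v)
  ... | no u≢v with comp u ≟ i
  ...   | yes eq  = yes (inj₁ (u≢v , eq))
  ...   | no ¬eq  = no λ { (inj₁ (_ , eq)) → ¬eq eq ; (inj₂ u≡v) → u≢v u≡v }

  compPlus-gate : ∀ i {x z} → Adj G x z →
                  CompPlus v comp i x → ¬ CompPlus v comp i z → x ≡ v
  compPlus-gate i {x} {z} e hx ¬hz with x ≟ v
  ... | yes x≡v = x≡v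
  ... | no x≢v  = ⊥-elim (¬hz (inj₁ (z≢v , trans (≡-sym (same-component e x≢v z≢v))
                                                 (compPlus-comp hx x≢v))))
    where
    z≢v : z ≢ v
    z≢v z≡v = ¬hz (inj₂ z≡v)

  module Component (i : Fin k) = Gated G (compPlus? i) v (compPlus-gate i)

  compPlus-disjoint : ∀ {i j x} → j ≢ i → CompPlus v comp j x → x ≢ v → ¬ CompPlus v comp i x
  compPlus-disjoint j≢i hj x≢v hi = j≢i (trans (≡-sym (compPlus-comp hj x≢v)) (compPlus-comp hi x≢v))

  edge-in-component : ∀ {a b} → Adj G a b →
    Σ (Fin k) λ i → CompPlus v comp i a × CompPlus v comp i b
  edge-in-component {a} {b} e with a ≟ v | b ≟ v
  ... | yes a≡v | _       = comp b , inj₂ a≡v , inj₁ (b≢v , refl)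
    where
    b≢v : b ≢ v
    b≢v b≡v = irrefl G (subst (Adj G a) (trans b≡v (≡-sym a≡v)) e)
  ... | no a≢v  | yes b≡v = comp a , inj₁ (a≢v , refl) , inj₂ b≡v
  ... | no a≢v  | no b≢v  = comp a , inj₁ (a≢v , refl) , inj₁ (b≢v , ≡-sym (same-component e a≢v b≢v))

  ¬monitors-v-v : ∀ {i hv hv′ c d} → ¬ Monitors (Induced G (CompPlus v comp i)) (v , hv) (v , hv′) c d
  ¬monitors-v-v {hv = inj₁ (v≢v , _)}                        _ = v≢v refl
  ¬monitors-v-v {hv = inj₂ _}         {hv′ = inj₁ (v≢v , _)} _ = v≢v refl
  ¬monitors-v-v {hv = inj₂ refl}      {hv′ = inj₂ refl}      m = Walks.¬monitors-self _ m

  another-component : IsCutVertex G v → ∀ i → Σ (Fin k) λ j → j ≢ i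
  another-component ((u , u≢v) , (w , w≢v) , ¬walk) i with comp u ≟ i
  ... | no  u∉i = comp u , u∉i
  ... | yes u∈i = comp w , λ w∈i →
          ¬walk (Equivalence.to (proj₂ lab u w u≢v w≢v) (trans u∈i (≡-sym w∈i)))

  MergedSet : (S : (i : Fin k) → Σ (Fin n) (CompPlus v comp i) → Set) → Fin n → Set
  MergedSet S u = u ≢ v × Σ (Fin k) λ i → Σ (CompPlus v comp i u) λ h → S i (u , h)

  module _ (S : (i : Fin k) → Σ (Fin n) (CompPlus v comp i) → Set) where

    -- Some vertex of another component has an edge, whose monitoring pair cannot be v, v.
    member-outside : Connected G → IsCutVertex G v →
      (∀ i → IsMEGSet (Induced G (CompPlus v comp i)) (S i)) →
      ∀ i → Σ (Fin n) λ w → MergedSet S w × ¬ CompPlus v comp i w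
    member-outside conn cut meg i with another-component cut i
    ... | j , j≢i with proj₁ lab j
    ...   | u , u≢v , u∈j with conn u v
    ...     | []               = ⊥-elim (u≢v refl)
    ...     | _∷_ {y = z} f _  with compPlus? j z
    ...       | no ¬hz = ⊥-elim (u≢v (compPlus-gate j f (inj₁ (u≢v , u∈j)) ¬hz))
    ...       | yes hz with meg j (u , inj₁ (u≢v , u∈j)) (z , hz) f
    ...         | (x , hx) , (y , hy) , sx , sy , m with x ≟ v | y ≟ v
    ...           | no x≢v   | _        = x , (x≢v , j , hx , sx) , compPlus-disjoint j≢i hx x≢v
    ...           | yes refl | no y≢v   = y , (y≢v , j , hy , sy) , compPlus-disjoint j≢i hy y≢v
    ...           | yes refl | yes refl = ⊥-elim (¬monitors-v-v m)

    merged-monitors : ∀ i {x y hx hy a b ha hb} → S i (x , hx) → S i (y , hy) →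
      Monitors (Induced G (CompPlus v comp i)) (x , hx) (y , hy) (a , ha) (b , hb) →
      Σ (Fin n) (λ w → MergedSet S w × ¬ CompPlus v comp i w) →
      Σ (Fin n) λ x′ → Σ (Fin n) λ y′ → MergedSet S x′ × MergedSet S y′ × Monitors G x′ y′ a b
    merged-monitors i {x} {y} {hx} {hy} sx sy m (w , sw , ¬hw) with x ≟ v | y ≟ v
    ... | yes refl | yes refl = ⊥-elim (¬monitors-v-v m)
    ... | yes refl | no y≢v   =
      w , y , sw , (y≢v , i , hy , sy) , Component.monitors-from-outside i ¬hw (λ v≡y → y≢v (≡-sym v≡y)) m
    ... | no x≢v   | yes refl =
      x , w , (x≢v , i , hx , sx) , sw ,
      monitors-sym (Component.monitors-from-outside i ¬hw (λ v≡x → x≢v (≡-sym v≡x))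
                      (Walks.monitors-sym (Induced G (CompPlus v comp i)) m))
    ... | no x≢v   | no y≢v with x ≟ y
    ...   | yes refl = w , x , sw , (x≢v , i , hx , sx) ,
                       Component.monitors-from-twins i x≢v (λ w≡x → ¬hw (subst _ (≡-sym w≡x) hx)) m
    ...   | no x≢y   = x , y , (x≢v , i , hx , sx) , (y≢v , i , hy , sy) ,
                       Component.monitors-lift i x≢y m

lemma3 : (n : ℕ) (G : Graph (Fin n)) → Connected G →
    (v : Fin n) → IsCutVertex G v →
    (k : ℕ) (comp : Fin n → Fin k) → IsComponentLabelling G v k comp →
    (S : (i : Fin k) → Σ (Fin n) (CompPlus v comp i) → Set) →
    (∀ i → IsMEGSet (Induced G (CompPlus v comp i)) (S i)) →
    IsMEGSet G (λ u → u ≢ v × Σ (Fin k) λ i →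
                  Σ (CompPlus v comp i u) λ h → S i (u , h))
lemma3 n G conn v cut k comp lab S meg a b e =
  let i , ha , hb                      = edge-in-component e
      (x , hx) , (y , hy) , sx , sy , m = meg i (a , ha) (b , hb) e
  in merged-monitors S i sx sy m (member-outside S conn cut meg i)
  where open CutVertexComponents G v comp lab
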